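{- For every even integer $k\ge 0$, $M_{k,\mathrm{T}\cdots\mathrm{F}}\ge\sqrt{2}^{\,k}$.
   Context: Unordered CNF game: an instance is a pair $(\varphi,X)$ where $\varphi$ is a CNF formula (a set of clauses, each clause a disjunction of literals $x_i$ or $\overline{x}_i$) and $X$ is a finite set of boolean variables containing every variable appearing in $\varphi$. Two players, T and F, alternate turns; on each turn the player picks a not-yet-assigned variable from $X$ and assigns it $0$ or $1$. The game ends when all variables are assigned; T wins if $\varphi$ is satisfied and F wins otherwise. A CNF is $k$-uniform if every clause has exactly $k$ literals, on $k$ distinct variables. $M_{k,\mathrm{T}\cdots\mathrm{F}}$ denotes the minimum number of clauses of $\varphi$ over all instances $(\varphi,X)$ with $\varphi$ $k$-uniform and $|X|$ even such that F has a winning strategy when T moves first (so F moves last). -}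

module Defs where

open import Data.Nat using (ℕ; _*_)
open import Data.Bool using (Bool)
open import Data.Fin using (Fin; _≟_)
open import Data.Maybe using (Maybe; just; nothing)
open import Data.Product using (_×_; _,_; ∃; Σ; proj₁)
open import Data.List using (List; length; map)
open import Data.List.Relation.Unary.All using (All)
open import Data.List.Relation.Unary.Any using (Any)
open import Data.List.Relation.Unary.Unique.Propositional using (Unique)
open import Relation.Binary.PropositionalEquality using (_≡_; _≢_)
open import Relation.Nullary using (¬_; yes; no)

Even : ℕ → Set
Even k = ∃ λ m → k ≡ 2 * m

-- Variables of X are identified with Fin n (so |X| = n).
-- A literal is a pair (variable, polarity): (i , true) is x_i, (i , false) is ¬x_i.
Literal : ℕ → Set
Literal n = Fin n × Bool

Clause : ℕ → Set
Clause n = List (Literal n)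

CNF : ℕ → Set
CNF n = List (Clause n)

KClause : ∀ {n} → ℕ → Clause n → Set
KClause k c = length c ≡ k × Unique (map proj₁ c)

KUniform : ∀ {n} → ℕ → CNF n → Set
KUniform k φ = All (KClause k) φ

PAssign : ℕ → Set
PAssign n = Fin n → Maybe Bool

empty : ∀ {n} → PAssign n
empty _ = nothing

set : ∀ {n} → PAssign n → Fin n → Bool → PAssign n
set a i b j with j ≟ i
... | yes _ = just b
... | no _ = a j

Complete : ∀ {n} → PAssign n → Set
Complete a = ∀ i → a i ≢ nothing

LitTrue : ∀ {n} → PAssign n → Literal n → Set
LitTrue a (i , b) = a i ≡ just b

Satisfies : ∀ {n} → PAssign n → CNF n → Set
Satisfies a φ = All (Any (LitTrue a)) φ

data Player : Set where
  T F : Player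

-- FWins φ p a : from position a with player p to move, F has a winning strategy.
-- On each turn the mover picks an unassigned variable and a value for it.
data FWins {n} (φ : CNF n) : Player → PAssign n → Set where
  done  : ∀ {p a} → Complete a → ¬ Satisfies a φ → FWins φ p a
  fmove : ∀ {a} (i : Fin n) (b : Bool) → a i ≡ nothing →
          FWins φ T (set a i b) → FWins φ F a
  tmove : ∀ {a} → (Σ (Fin n) λ i → a i ≡ nothing) →
          (∀ (i : Fin n) (b : Bool) → a i ≡ nothing → FWins φ F (set a i b)) →
          FWins φ T a

module Submission where

-- T plays greedily against an Erdős–Selfridge potential. With λ = (q + d) / q, a clause
-- without satisfied literals weighs λ^(number of falsified literals); satisfied clauses
-- weigh nothing. If λ² ≤ 2, the potential (total weight) does not increase over a round
-- in which T sets the literal that satisfies the most weight P and F answers arbitrarily: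
-- by greediness the literals falsified by either move carried weight at most P, and F's
-- have grown by at most λ after T's move, so the round adds at most
-- (λ − 1)P + λ(λ − 1)P = (λ² − 1)P ≤ P while removing P. So if F still wins, the potential
-- starts at |φ| and ends at least at the weight λ^k of an all-false clause.
-- Weights are scaled by q^k to live in ℕ.
-- Taking (q + d) + q√2 = (1 + √2)^(2t+1), which gives λ² = 2 − 1/q², and letting q
-- grow, integrality of |φ| turns λ^(2j) ≤ |φ| into 2^j ≤ |φ|.

open import Defs
open import Data.Nat using (ℕ; _^_; _≤_; _/_)
open import Data.List using (length)
open import Data.Nat hiding (_≟_)
open import Data.Nat.Properties hiding (_≟_)
open import Data.Nat.DivMod using (m*n/n≡m)
open import Data.Nat.Tactic.RingSolver using (solve-∀)
open import Algebra.Properties.CommutativeSemigroup +-commutativeSemigroup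
  using () renaming (interchange to +-interchange)
open import Algebra.Properties.CommutativeSemigroup *-commutativeSemigroup
  using () renaming (x∙yz≈y∙xz to *-left-comm)
open import Data.Bool using (Bool; true; false; not)
import Data.Bool.Properties as Bool
open import Data.Empty using (⊥-elim)
open import Data.Fin using (Fin; _≟_)
open import Data.Maybe using (Maybe; just; nothing)
import Data.Maybe.Properties as Maybe
open import Data.Product using (_×_; _,_; proj₁; proj₂; Σ; ∃₂; uncurry)
open import Data.List using (List; []; _∷_; map; filter; cartesianProduct; allFin)
open import Data.List.Extrema.Nat using (argmax; argmax-all; f[xs]≤f[argmax])
open import Data.List.Membership.Propositional using (_∈_; find)
open import Data.List.Membership.Propositional.Properties
  using (∈-filter⁺; ∈-cartesianProduct⁺; ∈-allFin)
open import Data.List.Relation.Unary.All as All using (All; []; _∷_)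
open import Data.List.Relation.Unary.All.Properties using (¬All⇒Any¬; all-filter)
open import Data.List.Relation.Unary.AllPairs using (_∷_)
open import Data.List.Relation.Unary.Any using (Any; here; there; any?)
open import Data.List.Relation.Unary.Unique.Propositional using (Unique)
open import Function using (_∘_)
open import Relation.Binary.PropositionalEquality
open import Relation.Nullary using (¬_; Dec; yes; no)
open import Relation.Unary using (Decidable)

∑ : {A : Set} → List A → (A → ℕ) → ℕ
∑ []       f = 0
∑ (x ∷ xs) f = f x + ∑ xs f

infix 5 ∑
syntax ∑ xs (λ x → e) = ∑[ x ∈ xs ] e

module _ {A : Set} where

  ∑-+ : ∀ (xs : List A) f g → ∑[ x ∈ xs ] (f x + g x) ≡ ∑ xs f + ∑ xs g
  ∑-+ []       f g = refl
  ∑-+ (x ∷ xs) f g = trans (cong (f x + g x +_) (∑-+ xs f g)) (+-interchange (f x) (g x) _ _)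

  ∑-*ˡ : ∀ (xs : List A) k f → ∑[ x ∈ xs ] (k * f x) ≡ k * ∑ xs f
  ∑-*ˡ []       k f = sym (*-zeroʳ k)
  ∑-*ˡ (x ∷ xs) k f = trans (cong (k * f x +_) (∑-*ˡ xs k f)) (sym (*-distribˡ-+ k (f x) _))

  ∑-congᴬ : ∀ {xs : List A} {f g} → All (λ x → f x ≡ g x) xs → ∑ xs f ≡ ∑ xs g
  ∑-congᴬ []         = refl
  ∑-congᴬ (eq ∷ eqs) = cong₂ _+_ eq (∑-congᴬ eqs)

  ∑-monoᴬ-≤ : ∀ {xs : List A} {f g} → All (λ x → f x ≤ g x) xs → ∑ xs f ≤ ∑ xs g
  ∑-monoᴬ-≤ []         = z≤n
  ∑-monoᴬ-≤ (le ∷ les) = +-mono-≤ le (∑-monoᴬ-≤ les)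

  ∈⇒≤∑ : ∀ {xs : List A} {x} f → x ∈ xs → f x ≤ ∑ xs f
  ∈⇒≤∑ {_ ∷ xs} f (here refl) = m≤m+n _ (∑ xs f)
  ∈⇒≤∑ {y ∷ _}  f (there x∈xs) = ≤-trans (∈⇒≤∑ f x∈xs) (m≤n+m _ (f y))

  ∑-const : ∀ (xs : List A) m → ∑[ x ∈ xs ] m ≡ length xs * m
  ∑-const []       m = refl
  ∑-const (x ∷ xs) m = cong (m +_) (∑-const xs m)

  ∑-linear : ∀ (xs : List A) k l f g → ∑[ x ∈ xs ] (k * f x + l * g x) ≡ k * ∑ xs f + l * ∑ xs g
  ∑-linear xs k l f g = trans (∑-+ xs _ _) (cong₂ _+_ (∑-*ˡ xs k f) (∑-*ˡ xs l g))

pell : ℕ → ℕ × ℕ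
pell zero    = 1 , 0
pell (suc t) = let q , d = pell t in 5 * q + 2 * d , 2 * q + d

pell-equation : ∀ t → let q , d = pell t in (q + d) * (q + d) + 1 ≡ 2 * (q * q)
pell-equation zero    = refl
pell-equation (suc t) = +-cancelʳ-≡ (2 * (q * q)) _ _ (begin
    (q′ + d′) * (q′ + d′) + 1 + 2 * (q * q)   ≡⟨ recurrence q d ⟩
    2 * (q′ * q′) + ((q + d) * (q + d) + 1)   ≡⟨ cong (2 * (q′ * q′) +_) (pell-equation t) ⟩
    2 * (q′ * q′) + 2 * (q * q)               ∎)
  where
  open ≡-Reasoning
  q = proj₁ (pell t)
  d = proj₂ (pell t)
  q′ = 5 * q + 2 * d
  d′ = 2 * q + d
  recurrence : ∀ q d → let q′ = 5 * q + 2 * d ; d′ = 2 * q + d in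
    (q′ + d′) * (q′ + d′) + 1 + 2 * (q * q) ≡ 2 * (q′ * q′) + ((q + d) * (q + d) + 1)
  recurrence = solve-∀

2^t≤pell : ∀ t → 2 ^ t ≤ proj₁ (pell t)
2^t≤pell zero    = ≤-refl
2^t≤pell (suc t) = begin
  2 * 2 ^ t                ≤⟨ *-monoʳ-≤ 2 (2^t≤pell t) ⟩
  2 * q                    ≤⟨ *-monoˡ-≤ q (m≤m+n 2 3) ⟩
  5 * q                    ≤⟨ m≤m+n (5 * q) (2 * d) ⟩
  5 * q + 2 * d            ∎
  where
  open ≤-Reasoning
  q = proj₁ (pell t)
  d = proj₂ (pell t)

pell-q≢0 : ∀ t → NonZero (proj₁ (pell t))
pell-q≢0 t = >-nonZero (≤-trans (m^n>0 2 t) (2^t≤pell t))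

pell-λ²≤2 : ∀ t → let q , d = pell t in (q + d) * (q + d) ≤ 2 * (q * q)
pell-λ²≤2 t = subst (λ x → (q + d) * (q + d) ≤ x) (pell-equation t) (m≤m+n _ 1)
  where
  q = proj₁ (pell t)
  d = proj₂ (pell t)

n<2^n : ∀ n → n < 2 ^ n
n<2^n zero    = s≤s z≤n
n<2^n (suc n) = begin-strict
  suc n             <⟨ +-monoʳ-< 1 (n<2^n n) ⟩
  1 + 2 ^ n         ≤⟨ +-monoˡ-≤ (2 ^ n) (m^n>0 2 n) ⟩
  2 ^ n + 2 ^ n     ≡⟨ cong (2 ^ n +_) (+-identityʳ (2 ^ n)) ⟨
  2 ^ suc n         ∎
  where open ≤-Reasoning

^-distribʳ-* : ∀ m n o → (m * n) ^ o ≡ m ^ o * n ^ o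
^-distribʳ-* m n zero    = refl
^-distribʳ-* m n (suc o) =
  trans (cong (m * n *_) (^-distribʳ-* m n o)) ([m*n]*[o*p]≡[m*o]*[n*p] m n (m ^ o) (n ^ o))

^-double : ∀ m n → m ^ (2 * n) ≡ (m * m) ^ n
^-double m n = trans (sym (^-*-assoc m 2 n)) (cong (λ x → (m * x) ^ n) (*-identityʳ m))

[1+m]^[1+n]≤m^[1+n]+[1+n]*[1+m]^n : ∀ m n → suc m ^ suc n ≤ m ^ suc n + suc n * suc m ^ n
[1+m]^[1+n]≤m^[1+n]+[1+n]*[1+m]^n m zero    = ≤-reflexive (base m)
  where
  base : ∀ m → suc m * 1 ≡ m * 1 + 1 * 1
  base = solve-∀
[1+m]^[1+n]≤m^[1+n]+[1+n]*[1+m]^n m (suc n) = begin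
  suc m * suc m ^ suc n                        ≤⟨ *-monoʳ-≤ (suc m) ([1+m]^[1+n]≤m^[1+n]+[1+n]*[1+m]^n m n) ⟩
  suc m * (m ^ suc n + suc n * suc m ^ n)      ≡⟨ expand m (m ^ suc n) (suc m ^ n) n ⟩
  m ^ suc (suc n) + m ^ suc n + suc n * suc m ^ suc n
    ≤⟨ +-monoˡ-≤ _ (+-monoʳ-≤ (m ^ suc (suc n)) (^-monoˡ-≤ (suc n) (n≤1+n m))) ⟩
  m ^ suc (suc n) + suc m ^ suc n + suc n * suc m ^ suc n  ≡⟨ +-assoc (m ^ suc (suc n)) _ _ ⟩
  m ^ suc (suc n) + suc (suc n) * suc m ^ suc n ∎
  where
  open ≤-Reasoning
  expand : ∀ m a b n → suc m * (a + suc n * b) ≡ m * a + a + suc n * (suc m * b)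
  expand = solve-∀

-- If m < 2^j then Q^j ≤ (2Q)^j − P^j ≤ j (2Q)^(j−1), i.e. Q ≤ j 2^(j−1).
P^j≤m*Q^j⇒2^j≤m : ∀ {P Q} j m → suc P ≡ 2 * Q → j * 2 ^ j < Q → P ^ j ≤ m * Q ^ j → 2 ^ j ≤ m
P^j≤m*Q^j⇒2^j≤m zero     m _ _ P^j≤mQ^j = ≤-trans P^j≤mQ^j (≤-reflexive (*-identityʳ m))
P^j≤m*Q^j⇒2^j≤m {P} {Q} j@(suc i) m 1+P≡2Q j2^j<Q P^j≤mQ^j = ≮⇒≥ λ m<2^j →
  <⇒≱ j2^j<Q (≤-trans (Q≤j2^i m<2^j) j2^i≤j2^j)
  where
  open ≤-Reasoning
  instance
    Q≢0 : NonZero Q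
    Q≢0 = >-nonZero (≤-<-trans z≤n j2^j<Q)
  j2^i≤j2^j : j * 2 ^ i ≤ j * 2 ^ j
  j2^i≤j2^j = *-monoʳ-≤ j (^-monoʳ-≤ 2 (n≤1+n i))
  Q≤j2^i : m < 2 ^ j → Q ≤ j * 2 ^ i
  Q≤j2^i m<2^j = *-cancelʳ-≤ Q (j * 2 ^ i) (Q ^ i) {{m^n≢0 Q i}} (+-cancelʳ-≤ (m * Q ^ j) _ _ (begin
    Q ^ j + m * Q ^ j             ≤⟨ *-monoˡ-≤ (Q ^ j) m<2^j ⟩
    2 ^ j * Q ^ j                 ≡⟨ ^-distribʳ-* 2 Q j ⟨
    (2 * Q) ^ j                   ≡⟨ cong (_^ j) 1+P≡2Q ⟨
    suc P ^ j                     ≤⟨ [1+m]^[1+n]≤m^[1+n]+[1+n]*[1+m]^n P i ⟩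
    P ^ j + j * suc P ^ i         ≤⟨ +-monoˡ-≤ _ P^j≤mQ^j ⟩
    m * Q ^ j + j * suc P ^ i     ≡⟨ +-comm (m * Q ^ j) _ ⟩
    j * suc P ^ i + m * Q ^ j     ≡⟨ cong (λ x → j * x ^ i + m * Q ^ j) 1+P≡2Q ⟩
    j * (2 * Q) ^ i + m * Q ^ j   ≡⟨ cong (λ x → j * x + m * Q ^ j) (^-distribʳ-* 2 Q i) ⟩
    j * (2 ^ i * Q ^ i) + m * Q ^ j ≡⟨ cong (_+ m * Q ^ j) (*-assoc j (2 ^ i) (Q ^ i)) ⟨
    j * 2 ^ i * Q ^ i + m * Q ^ j ∎))

pell-[q+d]^2j≤m*q^2j⇒2^j≤m : ∀ j m → let q , d = pell j in (q + d) ^ (2 * j) ≤ m * q ^ (2 * j) → 2 ^ j ≤ m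
pell-[q+d]^2j≤m*q^2j⇒2^j≤m j m bound = P^j≤m*Q^j⇒2^j≤m j m
  (trans (+-comm 1 _) (pell-equation j))
  (begin-strict
    j * 2 ^ j       <⟨ *-monoˡ-< (2 ^ j) {{m^n≢0 2 j}} (n<2^n j) ⟩
    2 ^ j * 2 ^ j   ≤⟨ *-mono-≤ (2^t≤pell j) (2^t≤pell j) ⟩
    q * q           ∎)
  (subst₂ (λ x y → x ≤ m * y) (^-double (q + d) j) (^-double q j) bound)
  where
  open ≤-Reasoning
  q = proj₁ (pell j)
  d = proj₂ (pell j)

module _ {n} (a : PAssign n) (v : Fin n) (b : Bool) where

  set-≢ : ∀ {i} → i ≢ v → set a v b i ≡ a i
  set-≢ {i} i≢v with i ≟ v
  ... | yes i≡v = ⊥-elim (i≢v i≡v)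
  ... | no _    = refl

  set-free⁻ : ∀ {i} → set a v b i ≡ nothing → a i ≡ nothing
  set-free⁻ {i} free with i ≟ v
  ... | no _ = free

polarity : ∀ {n} → Fin n → Clause n → Maybe Bool
polarity v []            = nothing
polarity v ((i , p) ∷ c) with i ≟ v
... | yes _ = just p
... | no _  = polarity v c

litTrue? : ∀ {n} (a : PAssign n) l → Dec (LitTrue a l)
litTrue? a (i , p) = Maybe.≡-dec Bool._≟_ (a i) (just p)

isSat : Maybe Bool → Bool → ℕ
isSat (just true)  true  = 1
isSat (just false) false = 1
isSat _            _     = 0

DistinctVars : ∀ {n} → CNF n → Set
DistinctVars φ = All (λ c → Unique (map proj₁ c)) φ

module Potential (q d : ℕ) where

  litWeight : Maybe Bool → Bool → ℕ
  litWeight nothing      _     = q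
  litWeight (just true)  true  = 0
  litWeight (just false) false = 0
  litWeight (just _)     _     = q + d

  litWeight-comm : ∀ x p → litWeight (just x) p ≡ litWeight (just p) x
  litWeight-comm true  true  = refl
  litWeight-comm true  false = refl
  litWeight-comm false true  = refl
  litWeight-comm false false = refl

  litWeight≤q+d : ∀ x p → litWeight x p ≤ q + d
  litWeight≤q+d nothing      _     = m≤m+n q d
  litWeight≤q+d (just true)  true  = z≤n
  litWeight≤q+d (just true)  false = ≤-refl
  litWeight≤q+d (just false) true  = ≤-refl
  litWeight≤q+d (just false) false = z≤n

  private
    satisfied-case : 0 + q * 1 ≡ q + d * 0
    satisfied-case = trans (*-identityʳ q) (sym (trans (cong (q +_) (*-zeroʳ d)) (+-identityʳ q)))

    falsified-case : q + d + q * 0 ≡ q + d * 1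
    falsified-case = trans (trans (cong (q + d +_) (*-zeroʳ q)) (+-identityʳ _)) (cong (q +_) (sym (*-identityʳ d)))

  litWeight+q*isSat≡q+d*isSat¬ : ∀ x p → litWeight x p + q * isSat x p ≡ q + d * isSat x (not p)
  litWeight+q*isSat≡q+d*isSat¬ nothing      _     = cong (q +_) (trans (*-zeroʳ q) (sym (*-zeroʳ d)))
  litWeight+q*isSat≡q+d*isSat¬ (just true)  true  = satisfied-case
  litWeight+q*isSat≡q+d*isSat¬ (just true)  false = falsified-case
  litWeight+q*isSat≡q+d*isSat¬ (just false) true  = falsified-case
  litWeight+q*isSat≡q+d*isSat¬ (just false) false = satisfied-case

  weight : ∀ {n} → PAssign n → Clause n → ℕ
  weight a []            = 1
  weight a ((i , p) ∷ c) = litWeight (a i) p * weight a c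

  potential : ∀ {n} → PAssign n → CNF n → ℕ
  potential a φ = ∑[ c ∈ φ ] weight a c

  gain : ∀ {n} → PAssign n → Fin n → Bool → CNF n → ℕ
  gain a v b φ = ∑[ c ∈ φ ] isSat (polarity v c) b * weight a c

  weight-set-∉ : ∀ {n} (a : PAssign n) {v b} c → All (v ≢_) (map proj₁ c) → weight (set a v b) c ≡ weight a c
  weight-set-∉ a []            []           = refl
  weight-set-∉ a {v} {b} ((i , p) ∷ c) (v≢i ∷ v∉c) =
    cong₂ _*_ (cong (λ x → litWeight x p) (set-≢ a v b (≢-sym v≢i))) (weight-set-∉ a c v∉c)

  -- litWeight is symmetric on assigned variables, so the factor on the right is the new
  -- weight of c's literal on v. Matching on i ≟ v below also evaluates set a v b i and
  -- polarity v, which test the same equality.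
  weight-set : ∀ {n} (a : PAssign n) {v} b c → a v ≡ nothing → Unique (map proj₁ c) →
    q * weight (set a v b) c ≡ litWeight (polarity v c) b * weight a c
  weight-set a b []            _      _               = refl
  weight-set a {v} b ((i , p) ∷ c) v-free (i∉c ∷ c-uniq) with i ≟ v
  ... | yes refl = begin
    q * (litWeight (just b) p * weight (set a v b) c) ≡⟨ cong (λ w → q * (litWeight (just b) p * w)) (weight-set-∉ a c i∉c) ⟩
    q * (litWeight (just b) p * weight a c)            ≡⟨ *-left-comm q (litWeight (just b) p) (weight a c) ⟩
    litWeight (just b) p * (q * weight a c)            ≡⟨ cong₂ (λ x y → x * (litWeight y p * weight a c)) (litWeight-comm b p) (sym v-free) ⟩
    litWeight (just p) b * (litWeight (a v) p * weight a c) ∎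
    where open ≡-Reasoning
  ... | no _ = begin
    q * (litWeight (a i) p * weight (set a v b) c)                ≡⟨ *-left-comm q (litWeight (a i) p) (weight (set a v b) c) ⟩
    litWeight (a i) p * (q * weight (set a v b) c)                ≡⟨ cong (litWeight (a i) p *_) (weight-set a b c v-free c-uniq) ⟩
    litWeight (a i) p * (litWeight (polarity v c) b * weight a c) ≡⟨ *-left-comm (litWeight (a i) p) (litWeight (polarity v c) b) (weight a c) ⟩
    litWeight (polarity v c) b * (litWeight (a i) p * weight a c) ∎
    where open ≡-Reasoning

  potential-set : ∀ {n} (a : PAssign n) {y} b φ → a y ≡ nothing → DistinctVars φ →
    q * potential (set a y b) φ + q * gain a y b φ ≡ q * potential a φ + d * gain a y (not b) φ
  potential-set a {y} b φ y-free distinct = begin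
    q * potential (set a y b) φ + q * gain a y b φ
      ≡⟨ ∑-linear φ q q _ _ ⟨
    ∑[ c ∈ φ ] (q * weight (set a y b) c + q * (isSat (polarity y c) b * weight a c))
      ≡⟨ ∑-congᴬ (All.map clause distinct) ⟩
    ∑[ c ∈ φ ] (q * weight a c + d * (isSat (polarity y c) (not b) * weight a c))
      ≡⟨ ∑-linear φ q d _ _ ⟩
    q * potential a φ + d * gain a y (not b) φ ∎
    where
    open ≡-Reasoning
    expand : ∀ l k s w → (l + k * s) * w ≡ l * w + k * (s * w)
    expand l k s w = trans (*-distribʳ-+ w l (k * s)) (cong (l * w +_) (*-assoc k s w))
    clause : ∀ {c} → Unique (map proj₁ c) →
      q * weight (set a y b) c + q * (isSat (polarity y c) b * weight a c) ≡
      q * weight a c + d * (isSat (polarity y c) (not b) * weight a c)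
    clause {c} distinct-c = begin
      q * weight (set a y b) c + q * (s * w)  ≡⟨ cong (_+ q * (s * w)) (weight-set a b c y-free distinct-c) ⟩
      litWeight x b * w + q * (s * w)         ≡⟨ expand (litWeight x b) q s w ⟨
      (litWeight x b + q * s) * w             ≡⟨ cong (_* w) (litWeight+q*isSat≡q+d*isSat¬ x b) ⟩
      (q + d * isSat x (not b)) * w           ≡⟨ expand q d _ w ⟩
      q * w + d * (isSat x (not b) * w)       ∎
      where
      x = polarity y c
      s = isSat x b
      w = weight a c

  gain-set≤ : ∀ {n} (a : PAssign n) {y} b z e φ → a y ≡ nothing → DistinctVars φ →
    q * gain (set a y b) z e φ ≤ (q + d) * gain a z e φ
  gain-set≤ a {y} b z e φ y-free distinct = begin
    q * gain (set a y b) z e φ                                   ≡⟨ ∑-*ˡ φ q _ ⟨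
    ∑[ c ∈ φ ] (q * (isSat (polarity z c) e * weight (set a y b) c)) ≤⟨ ∑-monoᴬ-≤ (All.map clause distinct) ⟩
    ∑[ c ∈ φ ] ((q + d) * (isSat (polarity z c) e * weight a c))     ≡⟨ ∑-*ˡ φ (q + d) _ ⟩
    (q + d) * gain a z e φ                                        ∎
    where
    open ≤-Reasoning
    clause : ∀ {c} → Unique (map proj₁ c) →
      q * (isSat (polarity z c) e * weight (set a y b) c) ≤ (q + d) * (isSat (polarity z c) e * weight a c)
    clause {c} distinct-c = begin
      q * (s * weight (set a y b) c)          ≡⟨ *-left-comm q s _ ⟩
      s * (q * weight (set a y b) c)          ≡⟨ cong (s *_) (weight-set a b c y-free distinct-c) ⟩
      s * (litWeight (polarity y c) b * w)    ≤⟨ *-monoʳ-≤ s (*-monoˡ-≤ w (litWeight≤q+d (polarity y c) b)) ⟩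
      s * ((q + d) * w)                       ≡⟨ *-left-comm s (q + d) w ⟩
      (q + d) * (s * w)                       ∎
      where
      s = isSat (polarity z c) e
      w = weight a c

  litWeight-falsified : ∀ x p → x ≢ p → litWeight (just x) p ≡ q + d
  litWeight-falsified true  true  x≢p = ⊥-elim (x≢p refl)
  litWeight-falsified true  false _   = refl
  litWeight-falsified false true  _   = refl
  litWeight-falsified false false x≢p = ⊥-elim (x≢p refl)

  weight-falsified : ∀ {n} {a : PAssign n} c → Complete a → ¬ Any (LitTrue a) c → weight a c ≡ (q + d) ^ length c
  weight-falsified         []            _        _     = refl
  weight-falsified {a = a} ((i , p) ∷ c) complete unsat with a i in ai≡x
  ... | nothing = ⊥-elim (complete i ai≡x)
  ... | just x  = cong₂ _*_
    (litWeight-falsified x p (λ x≡p → unsat (here (trans ai≡x (cong just x≡p)))))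
    (weight-falsified c complete (unsat ∘ there))

  potential-falsified : ∀ {n k} {a : PAssign n} {φ} → All (λ c → length c ≡ k) φ →
    Complete a → ¬ Satisfies a φ → (q + d) ^ k ≤ potential a φ
  potential-falsified {k = k} {a} {φ} lengths complete unsat
    with c , c∈φ , c-unsat ← find (¬All⇒Any¬ (any? (litTrue? a)) φ unsat) = begin
    (q + d) ^ k          ≡⟨ cong ((q + d) ^_) (All.lookup lengths c∈φ) ⟨
    (q + d) ^ length c   ≡⟨ weight-falsified c complete c-unsat ⟨
    weight a c           ≤⟨ ∈⇒≤∑ (weight a) c∈φ ⟩
    potential a φ        ∎
    where
    open ≤-Reasoning

  weight-empty : ∀ {n} (c : Clause n) → weight empty c ≡ q ^ length c
  weight-empty []      = refl
  weight-empty (_ ∷ c) = cong (q *_) (weight-empty c)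

  potential-empty : ∀ {n k} {φ : CNF n} → All (λ c → length c ≡ k) φ → potential empty φ ≡ length φ * q ^ k
  potential-empty {k = k} {φ} lengths =
    trans (∑-congᴬ (All.map (λ {c} len → trans (weight-empty c) (cong (q ^_) len)) lengths)) (∑-const φ (q ^ k))

∈-bools : ∀ b → b ∈ true ∷ false ∷ []
∈-bools true  = here refl
∈-bools false = there (here refl)

best-move : ∀ {n} (a : PAssign n) (g : Fin n → Bool → ℕ) → Σ (Fin n) (λ i → a i ≡ nothing) →
  ∃₂ λ y b → a y ≡ nothing × (∀ z e → a z ≡ nothing → g z e ≤ g y b)
best-move {n} a g (i , i-free) = proj₁ best , proj₂ best , best-free , best-maximal
  where
  free? : Decidable (λ (m : Fin n × Bool) → a (proj₁ m) ≡ nothing)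
  free? (j , _) = Maybe.≡-dec Bool._≟_ (a j) nothing
  candidates moves : List (Fin n × Bool)
  candidates = cartesianProduct (allFin n) (true ∷ false ∷ [])
  moves = filter free? candidates
  best : Fin n × Bool
  best = argmax (uncurry g) (i , true) moves
  best-free : a (proj₁ best) ≡ nothing
  best-free = argmax-all (uncurry g) {P = λ m → a (proj₁ m) ≡ nothing} {xs = moves}
    i-free (all-filter free? candidates)
  best-maximal : ∀ z e → a z ≡ nothing → g z e ≤ uncurry g best
  best-maximal z e z-free = All.lookup (f[xs]≤f[argmax] (i , true) moves)
    (∈-filter⁺ free? (∈-cartesianProduct⁺ (∈-allFin z) (∈-bools e)) z-free)

k*x+k*p≤k*y+r⇒x≤y : ∀ k {x y p r} .{{_ : NonZero k}} → k * x + k * p ≤ k * y + r → r ≤ k * p → x ≤ y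
k*x+k*p≤k*y+r⇒x≤y k {x} {y} {p} le r≤kp =
  *-cancelˡ-≤ k (+-cancelʳ-≤ (k * p) (k * x) (k * y) (≤-trans le (+-monoʳ-≤ (k * y) r≤kp)))

module Greedy (q d : ℕ) .{{_ : NonZero q}} (λ²≤2 : (q + d) * (q + d) ≤ 2 * (q * q))
              {n k} (φ : CNF n) (uniform : KUniform k φ) where

  open Potential q d

  lengths : All (λ c → length c ≡ k) φ
  lengths = All.map proj₁ uniform

  distinct : DistinctVars φ
  distinct = All.map proj₂ uniform

  excess≤q² : q * d + d * (q + d) ≤ q * q
  excess≤q² = +-cancelˡ-≤ (q * q) _ _ (begin
    q * q + (q * d + d * (q + d)) ≡⟨ square q d ⟩
    (q + d) * (q + d)             ≤⟨ λ²≤2 ⟩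
    2 * (q * q)                   ≡⟨ cong (q * q +_) (+-identityʳ (q * q)) ⟩
    q * q + q * q                 ∎)
    where
    open ≤-Reasoning
    square : ∀ q d → q * q + (q * d + d * (q + d)) ≡ (q + d) * (q + d)
    square = solve-∀

  d≤q : d ≤ q
  d≤q = *-cancelˡ-≤ q (≤-trans (m≤m+n (q * d) _) excess≤q²)

  potential-greedy₁ : ∀ {a y b} → a y ≡ nothing → gain a y (not b) φ ≤ gain a y b φ →
    potential (set a y b) φ ≤ potential a φ
  potential-greedy₁ {a} {y} {b} y-free best =
    k*x+k*p≤k*y+r⇒x≤y q (≤-reflexive (potential-set a b φ y-free distinct)) (*-mono-≤ d≤q best)

  potential-greedy₂ : ∀ {a y b z e} → a y ≡ nothing → set a y b z ≡ nothing →
    gain a y (not b) φ ≤ gain a y b φ → gain a z (not e) φ ≤ gain a y b φ →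
    potential (set (set a y b) z e) φ ≤ potential a φ
  potential-greedy₂ {a} {y} {b} {z} {e} y-free z-free best-y best-z =
    k*x+k*p≤k*y+r⇒x≤y (q * q) {{m*n≢0 q q}} two-moves (begin
      q * d * N + d * (q + d) * W       ≤⟨ +-mono-≤ (*-monoʳ-≤ (q * d) best-y) (*-monoʳ-≤ (d * (q + d)) best-z) ⟩
      q * d * P + d * (q + d) * P       ≡⟨ *-distribʳ-+ P (q * d) (d * (q + d)) ⟨
      (q * d + d * (q + d)) * P         ≤⟨ *-monoˡ-≤ P excess≤q² ⟩
      q * q * P                         ∎)
    where
    open ≤-Reasoning
    a′ = set a y b
    P = gain a y b φ
    N = gain a y (not b) φ
    W = gain a z (not e) φ
    regroup₁ : ∀ q d x g p → q * (q * x + d * g) + q * q * p ≡ q * (q * x + q * p) + d * (q * g)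
    regroup₁ = solve-∀
    regroup₂ : ∀ q d x n w → q * (q * x + d * n) + d * ((q + d) * w) ≡ q * q * x + (q * d * n + d * (q + d) * w)
    regroup₂ = solve-∀
    two-moves : q * q * potential (set a′ z e) φ + q * q * P ≤ q * q * potential a φ + (q * d * N + d * (q + d) * W)
    two-moves = begin
      q * q * potential (set a′ z e) φ + q * q * P
        ≤⟨ +-monoˡ-≤ _ (≤-trans (≤-reflexive (*-assoc q q _)) (*-monoʳ-≤ q (m≤m+n _ (q * gain a′ z e φ)))) ⟩
      q * (q * potential (set a′ z e) φ + q * gain a′ z e φ) + q * q * P
        ≡⟨ cong (λ t → q * t + q * q * P) (potential-set a′ e φ z-free distinct) ⟩
      q * (q * potential a′ φ + d * gain a′ z (not e) φ) + q * q * P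
        ≡⟨ regroup₁ q d _ _ P ⟩
      q * (q * potential a′ φ + q * P) + d * (q * gain a′ z (not e) φ)
        ≡⟨ cong (λ t → q * t + d * (q * gain a′ z (not e) φ)) (potential-set a b φ y-free distinct) ⟩
      q * (q * potential a φ + d * N) + d * (q * gain a′ z (not e) φ)
        ≤⟨ +-monoʳ-≤ _ (*-monoʳ-≤ d (gain-set≤ a b z (not e) φ y-free distinct)) ⟩
      q * (q * potential a φ + d * N) + d * ((q + d) * W)
        ≡⟨ regroup₂ q d _ N W ⟩
      q * q * potential a φ + (q * d * N + d * (q + d) * W) ∎

  potential-bound : ∀ {a} → FWins φ T a → (q + d) ^ k ≤ potential a φ
  potential-bound (done complete unsat) = potential-falsified lengths complete unsat
  potential-bound {a} (tmove free reply)
    with y , b , y-free , best ← best-move a (λ z e → gain a z e φ) free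
    with reply y b y-free
  ... | done complete unsat = ≤-trans (potential-falsified lengths complete unsat)
                                      (potential-greedy₁ y-free (best y (not b) y-free))
  ... | fmove z e z-free F-wins = ≤-trans (potential-bound F-wins)
          (potential-greedy₂ y-free z-free (best y (not b) y-free) (best z (not e) (set-free⁻ a y b z-free)))

FWins⇒[q+d]^k≤|φ|*q^k : ∀ q d .{{_ : NonZero q}} → (q + d) * (q + d) ≤ 2 * (q * q) →
  ∀ {n k} (φ : CNF n) → KUniform k φ → FWins φ T empty → (q + d) ^ k ≤ length φ * q ^ k
FWins⇒[q+d]^k≤|φ|*q^k q d λ²≤2 {k = k} φ uniform F-wins =
  subst ((q + d) ^ k ≤_) (potential-empty lengths) (potential-bound F-wins)
  where
  open Potential q d
  open Greedy q d λ²≤2 φ uniform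

lemma8 : (k : ℕ) → Even k → (n : ℕ) → Even n → (φ : CNF n) → KUniform k φ →
    FWins φ T empty → 2 ^ (k / 2) ≤ length φ
lemma8 .(2 * j) (j , refl) n _ φ uniform F-wins =
  subst (λ h → 2 ^ h ≤ length φ) (sym 2j/2≡j) (pell-[q+d]^2j≤m*q^2j⇒2^j≤m j (length φ)
    (FWins⇒[q+d]^k≤|φ|*q^k q d {{pell-q≢0 j}} (pell-λ²≤2 j) φ uniform F-wins))
  where
  q = proj₁ (pell j)
  d = proj₂ (pell j)
  2j/2≡j : 2 * j / 2 ≡ j
  2j/2≡j = trans (cong (_/ 2) (*-comm 2 j)) (m*n/n≡m j 2)
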